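{- Let $d\in\mathcal{O}$ be monic and $\underline{c}\in\mathcal{O}^2$ primitive. For $\underline{a}/r\neq\underline{a}'/r'$ in $L(d\underline{c})$, written in lowest terms ($\gcd(a_1,a_2,r)=\gcd(a_1',a_2',r')=1$), at least one of the following holds: (i) $\left|\frac{a_i}{r}-\frac{a'_i}{r'}\right|\ge\frac{|dc_i^\bot|}{|rr'|}$ for both $i=1,2$; (ii) $\left|\frac{\underline{a}}{r}-\frac{\underline{a}'}{r'}\right|\ge\max\{|r|^{ -1},|r'|^{ -1}\}$; (iii) $\max_{i=1,2}\left\{|dc_i|\left|\frac{a_i}{r}-\frac{a'_i}{r'}\right|\right\}\ge 1$. Moreover, if $\underline{a}/r\in L(d\underline c)$ lies on $L_1(d\underline{c},k)$, then there exists $\underline{b}/r_2\in L_1(d\underline{c},k)$ (in lowest terms) with $\underline{b}/r_2\ne\underline{a}/r$ such that $|a_i/r-b_i/r_2|\le|dc_i^\bot|/|rr_2|$ for both $i=1,2$.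
   Context: $q$ a prime power, $K=\mathbb{F}_q(t)$, $\mathcal{O}=\mathbb{F}_q[t]$, $K_\infty=\mathbb{F}_q((t^{ -1}))$ with $|\alpha|=q^N$ for $\alpha=\sum_{i\le N}\alpha_it^i$, $\alpha_N\ne0$; vectors have max norm; $\mathbb{T}=\{|\alpha|<1\}$. $\underline{c}\in\mathcal{O}^2$ is primitive if $\gcd(c_1,c_2)=1$ and either $c_1$ is monic or $c_1=0$ and $c_2$ is monic; $\underline{c}^\bot=(c_1^\bot,c_2^\bot)=(-c_2,c_1)$. $L_1(d\underline{c},k)=\{\underline{x}\in K_\infty^2:d\underline{c}\cdot\underline{x}=k\}$ and $L(d\underline{c})$ is the set of $\underline{x}\in\mathbb{T}^2\cap K^2$ lying on $L_1(d\underline{c},k)$ for some $k\in\mathcal{O}$ with $\gcd(k,d)=1$. -}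

module Defs where

open import Level using (0ℓ)
open import Data.Nat using (ℕ; zero; suc)
open import Data.Integer as ℤ using (ℤ; +_)
open import Data.Fin using (Fin; zero; suc)
open import Data.List using (List; []; _∷_; length)
open import Data.Maybe using (Maybe; just; nothing)
open import Data.Product using (∃; _×_; _,_)
open import Data.Sum using (_⊎_)
open import Relation.Nullary using (¬_; yes; no)
open import Relation.Binary.PropositionalEquality using (_≡_; _≢_)
open import Relation.Binary.Definitions using (DecidableEquality)
open import Algebra.Structures using (IsCommutativeRing)
open import Function.Bundles using (_↔_)

record FiniteField : Set₁ where
  field
    F   : Set
    0F  : F
    1F  : F
    _+F_ : F → F → F
    _*F_ : F → F → F
    -F_ : F → F
    _⁻¹ : F → F
    isCommutativeRing : IsCommutativeRing _≡_ _+F_ _*F_ -F_ 0F 1F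
    0≢1 : 0F ≢ 1F
    inverse : ∀ x → x ≢ 0F → (x *F (x ⁻¹)) ≡ 1F
    _≟F_ : DecidableEquality F
    q : ℕ
    enum : F ↔ Fin q

module Poly (FF : FiniteField) where
  open FiniteField FF

  -- Polynomials in O = F_q[t], as coefficient lists (constant term first).
  P : Set
  P = List F

  zeroP : P
  zeroP = []

  oneP : P
  oneP = 1F ∷ []

  addP : P → P → P
  addP [] ys = ys
  addP (x ∷ xs) [] = x ∷ xs
  addP (x ∷ xs) (y ∷ ys) = (x +F y) ∷ addP xs ys

  negP : P → P
  negP [] = []
  negP (x ∷ xs) = (-F x) ∷ negP xs

  subP : P → P → P
  subP p s = addP p (negP s)

  scaleP : F → P → P
  scaleP a [] = []
  scaleP a (x ∷ xs) = (a *F x) ∷ scaleP a xs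

  mulP : P → P → P
  mulP [] ys = []
  mulP (x ∷ xs) ys = addP (scaleP x ys) (0F ∷ mulP xs ys)

  norm : P → P
  norm [] = []
  norm (x ∷ xs) with norm xs
  ... | y ∷ ys = x ∷ y ∷ ys
  ... | [] with x ≟F 0F
  ...   | yes _ = []
  ...   | no _ = x ∷ []

  _≈P_ : P → P → Set
  p ≈P s = norm p ≡ norm s

  -- degree; nothing = degree of the zero polynomial (-∞)
  deg : P → Maybe ℕ
  deg p with norm p
  ... | [] = nothing
  ... | (x ∷ xs) = just (length xs)

  lastF : P → Maybe F
  lastF [] = nothing
  lastF (x ∷ []) = just x
  lastF (x ∷ y ∷ ys) = lastF (y ∷ ys)

  lead : P → Maybe F
  lead p = lastF (norm p)

  Monic : P → Set
  Monic p = lead p ≡ just 1F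

  _∣P_ : P → P → Set
  g ∣P p = ∃ λ u → p ≈P mulP u g

  Coprime2 : P → P → Set
  Coprime2 x y = ∀ g → g ∣P x → g ∣P y → g ∣P oneP

  Coprime3 : P → P → P → Set
  Coprime3 x y z = ∀ g → g ∣P x → g ∣P y → g ∣P z → g ∣P oneP

  Vec2 : Set
  Vec2 = Fin 2 → P

  Primitive : Vec2 → Set
  Primitive c = Coprime2 (c zero) (c (suc zero))
    × (Monic (c zero) ⊎ (c zero ≈P zeroP × Monic (c (suc zero))))

  perp : Vec2 → Vec2
  perp c zero = negP (c (suc zero))
  perp c (suc zero) = c zero

  dot : Vec2 → Vec2 → P
  dot c a = addP (mulP (c zero) (a zero)) (mulP (c (suc zero)) (a (suc zero)))

  -- absolute values on K_∞: nothing = |0| = 0, just n = q^n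
  Abs : Set
  Abs = Maybe ℤ

  _≤A_ : Abs → Abs → Set
  nothing ≤A _ = Data.Unit.⊤ where import Data.Unit
  just m ≤A nothing = Data.Empty.⊥ where import Data.Empty
  just m ≤A just n = m ℤ.≤ n

  _<A_ : Abs → Abs → Set
  x <A y = ¬ (y ≤A x)

  maxA : Abs → Abs → Abs
  maxA nothing y = y
  maxA (just m) nothing = just m
  maxA (just m) (just n) = just (m ℤ.⊔ n)

  mulA : Abs → Abs → Abs
  mulA nothing _ = nothing
  mulA (just _) nothing = nothing
  mulA (just m) (just n) = just (m ℤ.+ n)

  one : Abs
  one = just (+ 0)

  absFrac : P → P → Abs
  absFrac p s with deg p | deg s
  ... | nothing | _ = nothing
  ... | just m | just n = just (+ m ℤ.- + n)
  ... | just m | nothing = nothing -- not used (s ≠ 0)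

  absP : P → Abs
  absP p = absFrac p oneP

  -- the point a/r (with a ∈ O², r ∈ O, r ≠ 0) lies on L₁(dc, k):  dc·(a/r) = k
  OnL1 : P → Vec2 → P → Vec2 → P → Set
  OnL1 d c k a r = mulP d (dot c a) ≈P mulP k r

  -- a/r lies in L(dc): a/r ∈ 𝕋² and on some L₁(dc,k) with gcd(k,d)=1
  InL : P → Vec2 → Vec2 → P → Set
  InL d c a r = ¬ (r ≈P zeroP) × (∀ i → absFrac (a i) r <A one)
    × ∃ λ k → OnL1 d c k a r × Coprime2 k d

  Lowest : Vec2 → P → Set
  Lowest a r = ¬ (r ≈P zeroP) × Coprime3 (a zero) (a (suc zero)) r

  Distinct : Vec2 → P → Vec2 → P → Set
  Distinct a r a' r' = ¬ (∀ i → mulP (a i) r' ≈P mulP (a' i) r)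

  -- |a_i/r - a'_i/r'| computed as |(a_i r' - a'_i r)/(r r')|
  δ : Vec2 → P → Vec2 → P → Fin 2 → Abs
  δ a r a' r' i = absFrac (subP (mulP (a i) r') (mulP (a' i) r)) (mulP r r')

module Submission where

-- A point a/r of L(dc) lies on some L₁(dc, k) with gcd(k, d) = 1, and
-- d (c·a) = k r then forces d ∣ r. For two points the numerators
-- n_i = a_i r' - a'_i r of the differences satisfy d (c·n) = (k - k') r r'.
-- If k ≠ k', the leading term of (k - k') r r' must come from one of the
-- d c_i n_i, which is (iii). If k = k', then c·n = 0, so n is a multiple of c^⊥
-- (c is primitive); as d divides n, in fact n = w d c^⊥ with w ≠ 0, which is
-- (i).
--
-- For the second part write r = s d and a = ν c^⊥ + s k w where w·c = 1. Then
-- gcd(ν, s) = 1, so u ν + t s = 1 with u ≠ 0, and b = k u w - t c^⊥, r₂ = d u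
-- lies on the same line, with a_i r₂ - b_i r = d c_i^⊥.

open import Defs
open import Level using (0ℓ)
open import Data.Nat as ℕ using (ℕ; zero; suc)
import Data.Nat.Properties as ℕP
open import Data.Integer as ℤ using (ℤ; +_; -[1+_])
import Data.Integer.Properties as ℤP
open import Data.Sign as Sign using (Sign)
open import Data.Unit using (tt)
open import Data.Fin using (Fin; zero; suc)
open import Data.List using ([]; _∷_; length)
open import Data.Maybe using (Maybe; just; nothing)
open import Data.Product using (∃₂; Σ; _×_; _,_; proj₁; proj₂)
open import Data.Sum using (_⊎_; inj₁; inj₂)
open import Data.Empty using (⊥; ⊥-elim)
open import Relation.Nullary using (¬_; yes; no; Dec)
open import Relation.Binary.Definitions using (tri<; tri≈; tri>)
open import Relation.Binary.PropositionalEquality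
open import Algebra.Bundles using (CommutativeRing)
open import Algebra.Solver.Ring.AlmostCommutativeRing
  using (fromCommutativeRing; _-Raw-AlmostCommutative⟶_)
import Algebra.Solver.Ring
import Algebra.Properties.Ring
import Algebra.Properties.CommutativeSemigroup
import Algebra.Properties.Semiring.Mult
import Relation.Binary.Reasoning.Setoid

-- Ring normalisation with integer coefficients: constants such as 1 - 1 must
-- evaluate to 0 for p - p to normalise to 0, which coefficients drawn from an
-- abstract ring cannot do.
module IntegerCoefficientSolver (R : CommutativeRing 0ℓ 0ℓ) where
  private
    module R = CommutativeRing R
    module R⁻ = Algebra.Properties.Ring R.ring
    open R using (Carrier; _≈_; _+_; _*_; -_; 0#; 1#)
    open Algebra.Properties.CommutativeSemigroup R.+-commutativeSemigroup using (interchange)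
    open Algebra.Properties.Semiring.Mult R.semiring using (×-homo-+; ×1-homo-*) renaming (_×_ to _·_)
    open Relation.Binary.Reasoning.Setoid R.setoid

  ℕ→R : ℕ → Carrier
  ℕ→R n = n · 1#

  signed : Sign → Carrier → Carrier
  signed Sign.+ x = x
  signed Sign.- x = - x

  ℤ→R : ℤ → Carrier
  ℤ→R i = signed (ℤ.sign i) (ℕ→R ℤ.∣ i ∣)

  ℤ→R-⊖ : ∀ m n → ℤ→R (m ℤ.⊖ n) ≈ ℕ→R m + - ℕ→R n
  ℤ→R-⊖ m zero = begin
    ℤ→R (m ℤ.⊖ 0)   ≡⟨ cong ℤ→R (ℤP.⊖-≥ {m} {0} ℕ.z≤n) ⟩
    ℕ→R m           ≈⟨ R.+-identityʳ _ ⟨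
    ℕ→R m + 0#      ≈⟨ R.+-congˡ R⁻.-0#≈0# ⟨
    ℕ→R m + - 0#    ∎
  ℤ→R-⊖ zero (suc n) = begin
    ℤ→R (0 ℤ.⊖ suc n)     ≡⟨ cong ℤ→R (ℤP.⊖-< {0} {suc n} (ℕ.s≤s ℕ.z≤n)) ⟩
    - ℕ→R (suc n)         ≈⟨ R.+-identityˡ _ ⟨
    0# + - ℕ→R (suc n)    ∎
  ℤ→R-⊖ (suc m) (suc n) = begin
    ℤ→R (suc m ℤ.⊖ suc n)                 ≡⟨ cong ℤ→R (ℤP.[1+m]⊖[1+n]≡m⊖n m n) ⟩
    ℤ→R (m ℤ.⊖ n)                         ≈⟨ ℤ→R-⊖ m n ⟩
    ℕ→R m + - ℕ→R n                       ≈⟨ R.+-identityˡ _ ⟨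
    0# + (ℕ→R m + - ℕ→R n)                ≈⟨ R.+-congʳ (R.-‿inverseʳ 1#) ⟨
    (1# + - 1#) + (ℕ→R m + - ℕ→R n)       ≈⟨ interchange _ _ _ _ ⟩
    (1# + ℕ→R m) + (- 1# + - ℕ→R n)       ≈⟨ R.+-congˡ (R⁻.-‿+-comm 1# (ℕ→R n)) ⟩
    (1# + ℕ→R m) + - (1# + ℕ→R n)         ∎

  ℤ→R-+ : ∀ i j → ℤ→R (i ℤ.+ j) ≈ ℤ→R i + ℤ→R j
  ℤ→R-+ -[1+ m ] -[1+ n ] = begin
    - ℕ→R (suc (suc (m ℕ.+ n)))       ≡⟨ cong (λ k → - ℕ→R (suc k)) (ℕP.+-suc m n) ⟨
    - ℕ→R (suc m ℕ.+ suc n)           ≈⟨ R.-‿cong (×-homo-+ 1# (suc m) (suc n)) ⟩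
    - (ℕ→R (suc m) + ℕ→R (suc n))     ≈⟨ R⁻.-‿+-comm _ _ ⟨
    - ℕ→R (suc m) + - ℕ→R (suc n)     ∎
  ℤ→R-+ -[1+ m ] (+ n) = R.trans (ℤ→R-⊖ n (suc m)) (R.+-comm _ _)
  ℤ→R-+ (+ m) -[1+ n ] = ℤ→R-⊖ m (suc n)
  ℤ→R-+ (+ m) (+ n) = ×-homo-+ 1# m n

  ℤ→R-neg : ∀ i → ℤ→R (ℤ.- i) ≈ - ℤ→R i
  ℤ→R-neg (+ zero) = R.sym R⁻.-0#≈0#
  ℤ→R-neg (+ suc n) = R.refl
  ℤ→R-neg -[1+ n ] = R.sym (R⁻.-‿involutive _)

  ℤ→R-◃ : ∀ s n → ℤ→R (s ℤ.◃ n) ≈ signed s (ℕ→R n)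
  ℤ→R-◃ Sign.+ zero = R.refl
  ℤ→R-◃ Sign.- zero = R.sym R⁻.-0#≈0#
  ℤ→R-◃ Sign.+ (suc n) = R.refl
  ℤ→R-◃ Sign.- (suc n) = R.refl

  signed-cong : ∀ s {x y} → x ≈ y → signed s x ≈ signed s y
  signed-cong Sign.+ e = e
  signed-cong Sign.- e = R.-‿cong e

  signed-* : ∀ s t x y → signed (s Sign.* t) (x * y) ≈ signed s x * signed t y
  signed-* Sign.+ Sign.+ x y = R.refl
  signed-* Sign.+ Sign.- x y = R⁻.-‿distribʳ-* x y
  signed-* Sign.- Sign.+ x y = R⁻.-‿distribˡ-* x y
  signed-* Sign.- Sign.- x y = begin
    x * y           ≈⟨ R⁻.-‿involutive _ ⟨
    - - (x * y)     ≈⟨ R.-‿cong (R⁻.-‿distribʳ-* x y) ⟩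
    - (x * - y)     ≈⟨ R⁻.-‿distribˡ-* x (- y) ⟩
    - x * - y       ∎

  ℤ→R-* : ∀ i j → ℤ→R (i ℤ.* j) ≈ ℤ→R i * ℤ→R j
  ℤ→R-* i j = begin
    ℤ→R ((ℤ.sign i Sign.* ℤ.sign j) ℤ.◃ (ℤ.∣ i ∣ ℕ.* ℤ.∣ j ∣))
      ≈⟨ ℤ→R-◃ (ℤ.sign i Sign.* ℤ.sign j) (ℤ.∣ i ∣ ℕ.* ℤ.∣ j ∣) ⟩
    signed (ℤ.sign i Sign.* ℤ.sign j) (ℕ→R (ℤ.∣ i ∣ ℕ.* ℤ.∣ j ∣))
      ≈⟨ signed-cong (ℤ.sign i Sign.* ℤ.sign j) (×1-homo-* ℤ.∣ i ∣ ℤ.∣ j ∣) ⟩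
    signed (ℤ.sign i Sign.* ℤ.sign j) (ℕ→R ℤ.∣ i ∣ * ℕ→R ℤ.∣ j ∣)
      ≈⟨ signed-* (ℤ.sign i) (ℤ.sign j) _ _ ⟩
    ℤ→R i * ℤ→R j ∎

  private
    ℤ→R-morphism : ℤ.+-*-rawRing -Raw-AlmostCommutative⟶ fromCommutativeRing R
    ℤ→R-morphism = record
      { ⟦_⟧ = ℤ→R ; +-homo = ℤ→R-+ ; *-homo = ℤ→R-* ; -‿homo = ℤ→R-neg
      ; 0-homo = R.refl ; 1-homo = R.+-identityʳ 1# }

    ℤ→R-≟ : ∀ i j → Maybe (ℤ→R i ≈ ℤ→R j)
    ℤ→R-≟ i j with i ℤ.≟ j
    ... | yes refl = just R.refl
    ... | no _ = nothing

  open Algebra.Solver.Ring ℤ.+-*-rawRing (fromCommutativeRing R) ℤ→R-morphism ℤ→R-≟ public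

module Polynomials (FF : FiniteField) where
  open FiniteField FF
  open Poly FF

  F-ring : CommutativeRing 0ℓ 0ℓ
  F-ring = record { isCommutativeRing = isCommutativeRing }

  private
    module Fr = CommutativeRing F-ring
    module Fr⁻ = Algebra.Properties.Ring Fr.ring
    module Fr⁺ = Algebra.Properties.CommutativeSemigroup Fr.+-commutativeSemigroup

  coef : P → ℕ → F
  coef [] _ = 0F
  coef (x ∷ xs) zero = x
  coef (x ∷ xs) (suc n) = coef xs n

  -- Agrees with ≈P (≈P⇒≐, ≐⇒≈P) but, unlike the comparison of normal forms,
  -- makes the ring laws provable pointwise.
  infix 4 _≐_
  record _≐_ (p s : P) : Set where
    constructor mk
    field at : ∀ n → coef p n ≡ coef s n
  open _≐_ public

  coef-add : ∀ p s n → coef (addP p s) n ≡ coef p n +F coef s n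
  coef-add [] s n = sym (Fr.+-identityˡ _)
  coef-add (x ∷ p) [] n = sym (Fr.+-identityʳ _)
  coef-add (x ∷ p) (y ∷ s) zero = refl
  coef-add (x ∷ p) (y ∷ s) (suc n) = coef-add p s n

  coef-neg : ∀ p n → coef (negP p) n ≡ -F coef p n
  coef-neg [] n = sym Fr⁻.-0#≈0#
  coef-neg (x ∷ p) zero = refl
  coef-neg (x ∷ p) (suc n) = coef-neg p n

  coef-sub : ∀ p s n → coef (subP p s) n ≡ coef p n +F (-F coef s n)
  coef-sub p s n = trans (coef-add p (negP s) n) (cong (coef p n +F_) (coef-neg s n))

  coef-scale : ∀ a p n → coef (scaleP a p) n ≡ a *F coef p n
  coef-scale a [] n = sym (Fr.zeroʳ a)
  coef-scale a (x ∷ p) zero = refl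
  coef-scale a (x ∷ p) (suc n) = coef-scale a p n

  coef-mul-zero : ∀ x xs s → coef (mulP (x ∷ xs) s) zero ≡ x *F coef s zero
  coef-mul-zero x xs s = trans (coef-add (scaleP x s) (0F ∷ mulP xs s) zero)
    (trans (Fr.+-identityʳ _) (coef-scale x s zero))

  coef-mul-suc : ∀ x xs s n →
    coef (mulP (x ∷ xs) s) (suc n) ≡ (x *F coef s (suc n)) +F coef (mulP xs s) n
  coef-mul-suc x xs s n = trans (coef-add (scaleP x s) (0F ∷ mulP xs s) (suc n))
    (cong (_+F coef (mulP xs s) n) (coef-scale x s (suc n)))

  ≐-refl : ∀ {p} → p ≐ p
  ≐-refl = mk λ n → refl

  ≐-sym : ∀ {p s} → p ≐ s → s ≐ p
  ≐-sym e = mk λ n → sym (at e n)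

  ≐-trans : ∀ {p s t} → p ≐ s → s ≐ t → p ≐ t
  ≐-trans e f = mk λ n → trans (at e n) (at f n)

  cons-cong : ∀ {x y p s} → x ≡ y → p ≐ s → (x ∷ p) ≐ (y ∷ s)
  cons-cong e f = mk λ { zero → e ; (suc n) → at f n }

  tail-cong : ∀ {x y p s} → (x ∷ p) ≐ (y ∷ s) → p ≐ s
  tail-cong e = mk λ n → at e (suc n)

  add-cong : ∀ {p p' s s'} → p ≐ p' → s ≐ s' → addP p s ≐ addP p' s'
  add-cong {p} {p'} {s} {s'} e f = mk λ n → begin
    coef (addP p s) n     ≡⟨ coef-add p s n ⟩
    coef p n +F coef s n   ≡⟨ cong₂ _+F_ (at e n) (at f n) ⟩
    coef p' n +F coef s' n ≡⟨ coef-add p' s' n ⟨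
    coef (addP p' s') n   ∎
    where open ≡-Reasoning

  neg-cong : ∀ {p p'} → p ≐ p' → negP p ≐ negP p'
  neg-cong {p} {p'} e = mk λ n →
    trans (coef-neg p n) (trans (cong -F_ (at e n)) (sym (coef-neg p' n)))

  scale-cong : ∀ {a p p'} → p ≐ p' → scaleP a p ≐ scaleP a p'
  scale-cong {a} {p} {p'} e = mk λ n →
    trans (coef-scale a p n) (trans (cong (a *F_) (at e n)) (sym (coef-scale a p' n)))

  scale-zero : ∀ p → scaleP 0F p ≐ []
  scale-zero p = mk λ n → trans (coef-scale 0F p n) (Fr.zeroˡ _)

  add-identityʳ : ∀ p → addP p [] ≐ p
  add-identityʳ [] = ≐-refl
  add-identityʳ (x ∷ p) = ≐-refl

  add-assoc : ∀ p s t → addP (addP p s) t ≐ addP p (addP s t)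
  add-assoc p s t = mk λ n → begin
    coef (addP (addP p s) t) n            ≡⟨ coef-add (addP p s) t n ⟩
    coef (addP p s) n +F coef t n          ≡⟨ cong (_+F coef t n) (coef-add p s n) ⟩
    (coef p n +F coef s n) +F coef t n      ≡⟨ Fr.+-assoc _ _ _ ⟩
    coef p n +F (coef s n +F coef t n)      ≡⟨ cong (coef p n +F_) (coef-add s t n) ⟨
    coef p n +F coef (addP s t) n          ≡⟨ coef-add p (addP s t) n ⟨
    coef (addP p (addP s t)) n            ∎
    where open ≡-Reasoning

  add-comm : ∀ p s → addP p s ≐ addP s p
  add-comm p s = mk λ n →
    trans (coef-add p s n) (trans (Fr.+-comm _ _) (sym (coef-add s p n)))

  add-inverseʳ : ∀ p → addP p (negP p) ≐ []
  add-inverseʳ p = mk λ n → trans (coef-sub p p n) (Fr.-‿inverseʳ _)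

  add-interchange : ∀ p s t u → addP (addP p s) (addP t u) ≐ addP (addP p t) (addP s u)
  add-interchange p s t u = mk λ n → begin
    coef (addP (addP p s) (addP t u)) n
      ≡⟨ trans (coef-add (addP p s) (addP t u) n) (cong₂ _+F_ (coef-add p s n) (coef-add t u n)) ⟩
    (coef p n +F coef s n) +F (coef t n +F coef u n)
      ≡⟨ Fr⁺.interchange _ _ _ _ ⟩
    (coef p n +F coef t n) +F (coef s n +F coef u n)
      ≡⟨ trans (coef-add (addP p t) (addP s u) n) (cong₂ _+F_ (coef-add p t n) (coef-add s u n)) ⟨
    coef (addP (addP p t) (addP s u)) n ∎
    where open ≡-Reasoning

  scale-add : ∀ a p s → scaleP a (addP p s) ≐ addP (scaleP a p) (scaleP a s)
  scale-add a p s = mk λ n → begin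
    coef (scaleP a (addP p s)) n
      ≡⟨ trans (coef-scale a (addP p s) n) (cong (a *F_) (coef-add p s n)) ⟩
    a *F (coef p n +F coef s n)
      ≡⟨ Fr.distribˡ _ _ _ ⟩
    (a *F coef p n) +F (a *F coef s n)
      ≡⟨ trans (coef-add (scaleP a p) (scaleP a s) n) (cong₂ _+F_ (coef-scale a p n) (coef-scale a s n)) ⟨
    coef (addP (scaleP a p) (scaleP a s)) n ∎
    where open ≡-Reasoning

  scale-scale : ∀ a b p → scaleP a (scaleP b p) ≐ scaleP (a *F b) p
  scale-scale a b p = mk λ n → begin
    coef (scaleP a (scaleP b p)) n ≡⟨ trans (coef-scale a (scaleP b p) n) (cong (a *F_) (coef-scale b p n)) ⟩
    a *F (b *F coef p n)            ≡⟨ Fr.*-assoc _ _ _ ⟨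
    (a *F b) *F coef p n            ≡⟨ coef-scale (a *F b) p n ⟨
    coef (scaleP (a *F b) p) n     ∎
    where open ≡-Reasoning

  mul-congʳ : ∀ p {s s'} → s ≐ s' → mulP p s ≐ mulP p s'
  mul-congʳ [] e = ≐-refl
  mul-congʳ (x ∷ p) e = add-cong (scale-cong e) (cons-cong refl (mul-congʳ p e))

  mul-zeroˡ : ∀ {p} s → [] ≐ p → mulP p s ≐ []
  mul-zeroˡ {[]} s e = ≐-refl
  mul-zeroˡ {y ∷ p} s e =
    ≐-trans (add-cong (subst (λ a → scaleP a s ≐ []) (at e zero) (scale-zero s))
                      (cons-cong refl (mul-zeroˡ {p} s (mk λ n → at e (suc n)))))
            (mk λ { zero → refl ; (suc n) → refl })

  mul-zeroʳ : ∀ p → mulP p [] ≐ []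
  mul-zeroʳ [] = ≐-refl
  mul-zeroʳ (x ∷ p) = mk λ { zero → refl ; (suc n) → at (mul-zeroʳ p) n }

  mul-congˡ : ∀ {p p'} s → p ≐ p' → mulP p s ≐ mulP p' s
  mul-congˡ {[]} s e = ≐-sym (mul-zeroˡ s e)
  mul-congˡ {x ∷ p} {[]} s e = mul-zeroˡ s (≐-sym e)
  mul-congˡ {x ∷ p} {y ∷ p'} s e =
    add-cong (mk λ n → trans (coef-scale x s n) (trans (cong (_*F _) (at e zero)) (sym (coef-scale y s n))))
             (cons-cong refl (mul-congˡ s (tail-cong e)))

  mul-cong : ∀ {p p' s s'} → p ≐ p' → s ≐ s' → mulP p s ≐ mulP p' s'
  mul-cong {p' = p'} {s = s} e f = ≐-trans (mul-congˡ s e) (mul-congʳ p' f)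

  mul-consʳ : ∀ p y ys → mulP p (y ∷ ys) ≐ addP (scaleP y p) (0F ∷ mulP p ys)
  mul-consʳ [] y ys = mk λ { zero → refl ; (suc n) → refl }
  mul-consʳ (x ∷ xs) y ys = mk λ
    { zero → cong (_+F 0F) (Fr.*-comm x y)
    ; (suc n) → begin
        coef (addP (scaleP x ys) (mulP xs (y ∷ ys))) n
          ≡⟨ coef-add (scaleP x ys) _ n ⟩
        coef (scaleP x ys) n +F coef (mulP xs (y ∷ ys)) n
          ≡⟨ cong (_ +F_) (trans (at (mul-consʳ xs y ys) n) (coef-add (scaleP y xs) _ n)) ⟩
        coef (scaleP x ys) n +F (coef (scaleP y xs) n +F coef (0F ∷ mulP xs ys) n)
          ≡⟨ Fr⁺.x∙yz≈y∙xz _ _ _ ⟩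
        coef (scaleP y xs) n +F (coef (scaleP x ys) n +F coef (0F ∷ mulP xs ys) n)
          ≡⟨ cong (_ +F_) (coef-add (scaleP x ys) _ n) ⟨
        coef (scaleP y xs) n +F coef (addP (scaleP x ys) (0F ∷ mulP xs ys)) n
          ≡⟨ coef-add (scaleP y xs) _ n ⟨
        coef (addP (scaleP y xs) (addP (scaleP x ys) (0F ∷ mulP xs ys))) n ∎ }
    where open ≡-Reasoning

  mul-comm : ∀ p s → mulP p s ≐ mulP s p
  mul-comm [] s = ≐-sym (mul-zeroʳ s)
  mul-comm (x ∷ xs) s =
    ≐-trans (add-cong ≐-refl (cons-cong refl (mul-comm xs s))) (≐-sym (mul-consʳ s x xs))

  mul-distribˡ : ∀ p s t → mulP p (addP s t) ≐ addP (mulP p s) (mulP p t)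
  mul-distribˡ [] s t = ≐-refl
  mul-distribˡ (x ∷ xs) s t =
    ≐-trans (add-cong (scale-add x s t)
                      (≐-trans (cons-cong (sym (Fr.+-identityˡ 0F)) (mul-distribˡ xs s t)) ≐-refl))
            (add-interchange (scaleP x s) (scaleP x t) (0F ∷ mulP xs s) (0F ∷ mulP xs t))

  mul-distribʳ : ∀ p s t → mulP (addP s t) p ≐ addP (mulP s p) (mulP t p)
  mul-distribʳ p s t = ≐-trans (mul-comm (addP s t) p)
    (≐-trans (mul-distribˡ p s t) (add-cong (mul-comm p s) (mul-comm p t)))

  mul-scaleˡ : ∀ a p s → mulP (scaleP a p) s ≐ scaleP a (mulP p s)
  mul-scaleˡ a [] s = ≐-refl
  mul-scaleˡ a (x ∷ xs) s =
    ≐-trans (add-cong (≐-sym (scale-scale a x s)) (cons-cong (sym (Fr.zeroʳ a)) (mul-scaleˡ a xs s)))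
            (≐-sym (scale-add a (scaleP x s) (0F ∷ mulP xs s)))

  mul-assoc : ∀ p s t → mulP (mulP p s) t ≐ mulP p (mulP s t)
  mul-assoc [] s t = ≐-refl
  mul-assoc (x ∷ xs) s t =
    ≐-trans (mul-distribʳ t (scaleP x s) (0F ∷ mulP xs s))
            (add-cong (mul-scaleˡ x s t)
                      (≐-trans (add-cong (scale-zero t) ≐-refl) (cons-cong refl (mul-assoc xs s t))))

  mul-identityˡ : ∀ p → mulP oneP p ≐ p
  mul-identityˡ p = ≐-trans
    (add-cong {scaleP 1F p} {p} {0F ∷ []} {[]}
              (mk λ n → trans (coef-scale 1F p n) (Fr.*-identityˡ _))
              (mk λ { zero → refl ; (suc n) → refl }))
    (add-identityʳ p)

  mul-identityʳ : ∀ p → mulP p oneP ≐ p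
  mul-identityʳ p = ≐-trans (mul-comm p oneP) (mul-identityˡ p)

  P-ring : CommutativeRing 0ℓ 0ℓ
  P-ring = record
    { Carrier = P ; _≈_ = _≐_ ; _+_ = addP ; _*_ = mulP ; -_ = negP ; 0# = [] ; 1# = oneP
    ; isCommutativeRing = record
      { isRing = record
        { +-isAbelianGroup = record
          { isGroup = record
            { isMonoid = record
              { isSemigroup = record
                { isMagma = record
                  { isEquivalence = record { refl = ≐-refl ; sym = ≐-sym ; trans = ≐-trans }
                  ; ∙-cong = add-cong }
                ; assoc = add-assoc }
              ; identity = (λ p → ≐-refl) , add-identityʳ }
            ; inverse = (λ p → ≐-trans (add-comm (negP p) p) (add-inverseʳ p)) , add-inverseʳ
            ; ⁻¹-cong = neg-cong }
          ; comm = add-comm }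
        ; *-cong = mul-cong
        ; *-assoc = mul-assoc
        ; *-identity = mul-identityˡ , mul-identityʳ
        ; distrib = (λ p s t → mul-distribˡ p s t) , (λ p s t → mul-distribʳ p s t) }
      ; *-comm = mul-comm } }

  private
    module P⁻ = Algebra.Properties.Ring (CommutativeRing.ring P-ring)
    module ≐-Reasoning = Relation.Binary.Reasoning.Setoid (CommutativeRing.setoid P-ring)

  open IntegerCoefficientSolver P-ring using (solve; _:=_; _:+_; _:*_; _:-_; :-_)

  -- Normal forms and degrees

  cons-normal : F → P → P
  cons-normal x (y ∷ ys) = x ∷ y ∷ ys
  cons-normal x [] with x ≟F 0F
  ... | yes _ = []
  ... | no _ = x ∷ []

  norm-cons : ∀ x xs → norm (x ∷ xs) ≡ cons-normal x (norm xs)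
  norm-cons x xs with norm xs
  ... | y ∷ ys = refl
  ... | [] with x ≟F 0F
  ...   | yes _ = refl
  ...   | no _ = refl

  cons-normal-≐ : ∀ x p → cons-normal x p ≐ (x ∷ p)
  cons-normal-≐ x (y ∷ ys) = ≐-refl
  cons-normal-≐ x [] with x ≟F 0F
  ... | yes x≡0 = mk λ { zero → sym x≡0 ; (suc n) → refl }
  ... | no _ = ≐-refl

  cons-normal-zero : ∀ {x} → x ≡ 0F → cons-normal x [] ≡ []
  cons-normal-zero {x} x≡0 with x ≟F 0F
  ... | yes _ = refl
  ... | no x≢0 = ⊥-elim (x≢0 x≡0)

  norm-≐ : ∀ p → norm p ≐ p
  norm-≐ [] = ≐-refl
  norm-≐ (x ∷ xs) rewrite norm-cons x xs =
    ≐-trans (cons-normal-≐ x (norm xs)) (cons-cong refl (norm-≐ xs))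

  ≈P⇒≐ : ∀ {p s} → p ≈P s → p ≐ s
  ≈P⇒≐ {p} {s} e = ≐-trans (≐-sym (norm-≐ p)) (≐-trans (mk λ n → cong (λ t → coef t n) e) (norm-≐ s))

  ≐⇒≈P : ∀ {p s} → p ≐ s → p ≈P s
  ≐⇒≈P {[]} {[]} e = refl
  ≐⇒≈P {[]} {y ∷ ys} e
    rewrite norm-cons y ys | sym (≐⇒≈P {[]} {ys} (mk λ n → at e (suc n))) =
    sym (cons-normal-zero (sym (at e zero)))
  ≐⇒≈P {x ∷ xs} {[]} e
    rewrite norm-cons x xs | ≐⇒≈P {xs} {[]} (mk λ n → at e (suc n)) =
    cons-normal-zero (at e zero)
  ≐⇒≈P {x ∷ xs} {y ∷ ys} e rewrite norm-cons x xs | norm-cons y ys =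
    cong₂ cons-normal (at e zero) (≐⇒≈P (tail-cong e))

  NonZeroP : P → Set
  NonZeroP p = ¬ (p ≐ [])

  DegreeBelow : P → ℕ → Set
  DegreeBelow p n = ∀ m → n ℕ.≤ m → coef p m ≡ 0F

  HasDegree : P → ℕ → Set
  HasDegree p n = (coef p n ≢ 0F) × DegreeBelow p (suc n)

  HasDegree-unique : ∀ {p n m} → HasDegree p n → HasDegree p m → n ≡ m
  HasDegree-unique {n = n} {m} (pn≢0 , below-n) (pm≢0 , below-m) with ℕP.<-cmp n m
  ... | tri< n<m _ _ = ⊥-elim (pm≢0 (below-n m n<m))
  ... | tri≈ _ n≡m _ = n≡m
  ... | tri> _ _ m<n = ⊥-elim (pn≢0 (below-m n m<n))

  norm-view : ∀ p → (norm p ≡ [] × p ≐ [])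
                  ⊎ (∃₂ λ y ys → norm p ≡ y ∷ ys × HasDegree p (length ys))
  norm-view [] = inj₁ (refl , ≐-refl)
  norm-view (x ∷ xs) rewrite norm-cons x xs with norm-view xs
  ... | inj₂ (y , ys , e , y≢0 , below) rewrite e =
    inj₂ (x , y ∷ ys , refl , y≢0 , λ { zero () ; (suc m) (ℕ.s≤s le) → below m le })
  ... | inj₁ (e , xs≐0) rewrite e with x ≟F 0F
  ...   | yes x≡0 = inj₁ (refl , mk λ { zero → x≡0 ; (suc n) → at xs≐0 n })
  ...   | no x≢0 = inj₂ (x , [] , refl , x≢0 , λ { zero () ; (suc m) le → at xs≐0 m })

  zero-or-degree : ∀ p → (p ≐ []) ⊎ Σ ℕ (HasDegree p)
  zero-or-degree p with norm-view p
  ... | inj₁ (_ , p≐0) = inj₁ p≐0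
  ... | inj₂ (_ , ys , _ , has) = inj₂ (length ys , has)

  ≐[]? : ∀ p → Dec (p ≐ [])
  ≐[]? p with zero-or-degree p
  ... | inj₁ p≐0 = yes p≐0
  ... | inj₂ (n , p≢0 , _) = no λ p≐0 → p≢0 (at p≐0 n)

  deg-of-normal : P → Maybe ℕ
  deg-of-normal [] = nothing
  deg-of-normal (_ ∷ xs) = just (length xs)

  deg-norm : ∀ p → deg p ≡ deg-of-normal (norm p)
  deg-norm p with norm p
  ... | [] = refl
  ... | x ∷ xs = refl

  deg-HasDegree : ∀ {p n} → HasDegree p n → deg p ≡ just n
  deg-HasDegree {p} {n} has rewrite deg-norm p with norm-view p
  ... | inj₁ (_ , p≐0) = ⊥-elim (proj₁ has (at p≐0 n))
  ... | inj₂ (y , ys , e , has') rewrite e = cong just (HasDegree-unique {p} has' has)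

  deg-zero : ∀ {p} → p ≐ [] → deg p ≡ nothing
  deg-zero {p} p≐0 rewrite deg-norm p with norm-view p
  ... | inj₁ (e , _) rewrite e = refl
  ... | inj₂ (_ , _ , _ , p≢0 , _) = ⊥-elim (p≢0 (at p≐0 _))

  deg-cong : ∀ {p s} → p ≐ s → deg p ≡ deg s
  deg-cong {p} {s} e = trans (deg-norm p) (trans (cong deg-of-normal (≐⇒≈P e)) (sym (deg-norm s)))

  F-*-nonzero : ∀ {a b} → a ≢ 0F → b ≢ 0F → a *F b ≢ 0F
  F-*-nonzero {a} {b} a≢0 b≢0 ab≡0 = b≢0 (begin
    b                   ≡⟨ Fr.*-identityˡ b ⟨
    1F *F b             ≡⟨ cong (_*F b) (trans (Fr.*-comm _ _) (inverse a a≢0)) ⟨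
    ((a ⁻¹) *F a) *F b  ≡⟨ Fr.*-assoc _ _ _ ⟩
    (a ⁻¹) *F (a *F b)  ≡⟨ cong ((a ⁻¹) *F_) ab≡0 ⟩
    (a ⁻¹) *F 0F        ≡⟨ Fr.zeroʳ _ ⟩
    0F                  ∎)
    where open ≡-Reasoning

  coef-mul-top : ∀ p s n m → DegreeBelow p (suc n) → DegreeBelow s (suc m) →
    (coef (mulP p s) (n ℕ.+ m) ≡ coef p n *F coef s m) × DegreeBelow (mulP p s) (suc (n ℕ.+ m))
  coef-mul-top [] s n m _ _ = sym (Fr.zeroˡ _) , λ _ _ → refl
  coef-mul-top (x ∷ xs) s zero m below-p below-s = top , below
    where
    xs≐0 : mulP xs s ≐ []
    xs≐0 = mul-zeroˡ {xs} s (mk λ k → sym (below-p (suc k) (ℕ.s≤s ℕ.z≤n)))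
    coef-xs : ∀ m → coef (mulP (x ∷ xs) s) m ≡ x *F coef s m
    coef-xs zero = coef-mul-zero x xs s
    coef-xs (suc k) = trans (coef-mul-suc x xs s k)
      (trans (cong (_ +F_) (at xs≐0 k)) (Fr.+-identityʳ _))
    top = coef-xs m
    below : DegreeBelow (mulP (x ∷ xs) s) (suc m)
    below k le = trans (coef-xs k) (trans (cong (x *F_) (below-s k le)) (Fr.zeroʳ x))
  coef-mul-top (x ∷ xs) s (suc n) m below-p below-s = top , below
    where
    IH = coef-mul-top xs s n m (λ k le → below-p (suc k) (ℕ.s≤s le)) below-s
    x*s≡0 : ∀ k → suc m ℕ.≤ k → x *F coef s k ≡ 0F
    x*s≡0 k le = trans (cong (x *F_) (below-s k le)) (Fr.zeroʳ x)
    top = trans (coef-mul-suc x xs s (n ℕ.+ m))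
      (trans (cong₂ _+F_ (x*s≡0 _ (ℕ.s≤s (ℕP.m≤n+m m n))) (proj₁ IH)) (Fr.+-identityˡ _))
    below : DegreeBelow (mulP (x ∷ xs) s) (suc (suc (n ℕ.+ m)))
    below zero ()
    below (suc k) (ℕ.s≤s le) = trans (coef-mul-suc x xs s k)
      (trans (cong₂ _+F_ (x*s≡0 _ (ℕ.s≤s (ℕP.≤-trans (ℕP.m≤n+m m n) (ℕP.≤-trans (ℕP.n≤1+n _) le))))
                         (proj₂ IH k le))
             (Fr.+-identityˡ 0F))

  HasDegree-mul : ∀ {p s n m} → HasDegree p n → HasDegree s m → HasDegree (mulP p s) (n ℕ.+ m)
  HasDegree-mul {p} {s} {n} {m} (pn≢0 , below-p) (sm≢0 , below-s) =
    (λ e → F-*-nonzero pn≢0 sm≢0 (trans (sym (proj₁ top)) e)) , proj₂ top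
    where top = coef-mul-top p s n m below-p below-s

  mul-nonzero : ∀ {p s} → NonZeroP p → NonZeroP s → NonZeroP (mulP p s)
  mul-nonzero {p} {s} p≢0 s≢0 with zero-or-degree p | zero-or-degree s
  ... | inj₁ p≐0 | _ = ⊥-elim (p≢0 p≐0)
  ... | _ | inj₁ s≐0 = ⊥-elim (s≢0 s≐0)
  ... | inj₂ (n , has-p) | inj₂ (m , has-s) =
    λ ps≐0 → proj₁ (HasDegree-mul {p} {s} has-p has-s) (at ps≐0 (n ℕ.+ m))

  mul-cancelˡ : ∀ {d p s} → NonZeroP d → mulP d p ≐ mulP d s → p ≐ s
  mul-cancelˡ {d} {p} {s} d≢0 e with ≐[]? (subP p s)
  ... | yes p-s≐0 = P⁻.x∙y⁻¹≈ε⇒x≈y p s p-s≐0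
  ... | no p-s≢0 = ⊥-elim (mul-nonzero d≢0 p-s≢0 (begin
    mulP d (subP p s)                  ≈⟨ solve 3 (λ d p s → d :* (p :- s) := d :* p :- d :* s) ≐-refl d p s ⟩
    subP (mulP d p) (mulP d s)         ≈⟨ P⁻.x≈y⇒x∙y⁻¹≈ε e ⟩
    []                                 ∎))
    where open ≐-Reasoning

  -- Divisibility and Bézout

  infix 4 _∣_
  _∣_ : P → P → Set
  g ∣ p = Σ P λ u → p ≐ mulP u g

  ∣⇒∣P : ∀ {g p} → g ∣ p → g ∣P p
  ∣⇒∣P (u , e) = u , ≐⇒≈P e

  ∣P⇒∣ : ∀ {g p} → g ∣P p → g ∣ p
  ∣P⇒∣ (u , e) = u , ≈P⇒≐ e

  ∣-refl : ∀ {g} → g ∣ g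
  ∣-refl {g} = oneP , ≐-sym (mul-identityˡ g)

  ∣-respʳ : ∀ {g p s} → p ≐ s → g ∣ p → g ∣ s
  ∣-respʳ e (u , f) = u , ≐-trans (≐-sym e) f

  ∣-+ : ∀ {g p s} → g ∣ p → g ∣ s → g ∣ addP p s
  ∣-+ {g} (u , e) (v , f) = addP u v , ≐-trans (add-cong e f) (≐-sym (mul-distribʳ g u v))

  ∣-* : ∀ {g p} w → g ∣ p → g ∣ mulP w p
  ∣-* {g} w (u , e) = mulP w u , ≐-trans (mul-congʳ w e) (≐-sym (mul-assoc w u g))

  ∣-neg : ∀ {g p} → g ∣ p → g ∣ negP p
  ∣-neg {g} (u , e) = negP u ,
    ≐-trans (neg-cong e) (solve 2 (λ u g → :- (u :* g) := (:- u) :* g) ≐-refl u g)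

  record Division (a b : P) (n : ℕ) : Set where
    field
      quotient remainder : P
      identity : a ≐ addP (mulP quotient b) remainder
      remainder-small : DegreeBelow remainder n

  leading-term-cancelled : ∀ (e b : P) n → DegreeBelow e (suc n) → HasDegree b n →
    DegreeBelow (subP e (scaleP (coef e n *F (coef b n ⁻¹)) b)) n
  leading-term-cancelled e b n below-e (bn≢0 , below-b) k n≤k with ℕP.m≤n⇒m<n∨m≡n n≤k
  ... | inj₂ refl = trans (coef-sub e _ n) (trans (cong (λ z → coef e n +F (-F z)) scaled) (Fr.-‿inverseʳ _))
    where
    scaled : coef (scaleP (coef e n *F (coef b n ⁻¹)) b) n ≡ coef e n
    scaled = trans (coef-scale _ b n) (trans (Fr.*-assoc _ _ _)
      (trans (cong (coef e n *F_) (trans (Fr.*-comm _ _) (inverse (coef b n) bn≢0))) (Fr.*-identityʳ _)))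
  ... | inj₁ n<k = trans (coef-sub e _ k)
    (trans (cong₂ (λ u v → u +F (-F v)) (below-e k n<k)
                  (trans (coef-scale _ b k) (trans (cong (_ *F_) (below-b k n<k)) (Fr.zeroʳ _))))
           (trans (cong (0F +F_) Fr⁻.-0#≈0#) (Fr.+-identityʳ _)))

  divide : ∀ a b n → HasDegree b n → Division a b n
  divide [] b n _ = record { quotient = [] ; remainder = [] ; identity = ≐-refl ; remainder-small = λ _ _ → refl }
  divide (x ∷ xs) b n has-b = record
    { quotient = c ∷ Division.quotient D
    ; remainder = subP e (scaleP c b)
    ; identity = identity
    ; remainder-small = leading-term-cancelled e b n below-e has-b }
    where
    D = divide xs b n has-b
    e = x ∷ Division.remainder D
    c = coef e n *F (coef b n ⁻¹)
    below-e : DegreeBelow e (suc n)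
    below-e zero ()
    below-e (suc k) (ℕ.s≤s le) = Division.remainder-small D k le
    identity : (x ∷ xs) ≐ addP (mulP (c ∷ Division.quotient D) b) (subP e (scaleP c b))
    identity = ≐-trans (cons-cong refl (Division.identity D))
      (≐-trans (mk λ { zero → sym (Fr.+-identityˡ x) ; (suc k) → refl })
               (solve 3 (λ a e s → a :+ e := (s :+ a) :+ (e :- s)) ≐-refl
                      (0F ∷ mulP (Division.quotient D) b) e (scaleP c b)))

  record Gcd (a b : P) : Set where
    field
      g u v : P
      g≐combination : g ≐ addP (mulP u a) (mulP v b)
      g∣a : g ∣ a
      g∣b : g ∣ b

  euclid : ∀ n a b → DegreeBelow b n → Gcd a b
  euclid n a b below with zero-or-degree b
  ... | inj₁ b≐0 = record
    { g = a ; u = oneP ; v = [] ; g≐combination = ≐-sym (≐-trans (add-identityʳ _) (mul-identityˡ a))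
    ; g∣a = ∣-refl ; g∣b = [] , b≐0 }
  euclid zero a b below | inj₂ (m , bm≢0 , _) = ⊥-elim (bm≢0 (below m ℕ.z≤n))
  euclid (suc n) a b below | inj₂ (m , has-b) = record
    { g = g ; u = v ; v = subP u (mulP v quo)
    ; g≐combination = ≐-trans g≐combination
        (≐-trans (add-cong ≐-refl (mul-congʳ v rem≐))
          (solve 5 (λ u v a b q → u :* b :+ v :* (a :- q :* b) := v :* a :+ (u :- v :* q) :* b) ≐-refl u v a b quo))
    ; g∣a = ∣-respʳ (≐-sym (Division.identity D)) (∣-+ (∣-* quo g∣b) g∣r)
    ; g∣b = g∣b }
    where
    m≤n : m ℕ.≤ n
    m≤n with ℕP.<-cmp m (suc n)
    ... | tri< m<1+n _ _ = ℕP.≤-pred m<1+n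
    ... | tri≈ _ refl _ = ⊥-elim (proj₁ has-b (below m ℕP.≤-refl))
    ... | tri> _ _ m>1+n = ⊥-elim (proj₁ has-b (below m (ℕP.<⇒≤ m>1+n)))
    D = divide a b m has-b
    quo = Division.quotient D
    rem = Division.remainder D
    rem≐ : rem ≐ subP a (mulP quo b)
    rem≐ = ≐-trans (solve 3 (λ r q b → r := ((q :* b) :+ r) :- (q :* b)) ≐-refl rem quo b)
                 (add-cong (≐-sym (Division.identity D)) ≐-refl)
    open Gcd (euclid n b rem (λ k le → Division.remainder-small D k (ℕP.≤-trans m≤n le)))
      renaming (g∣a to g∣b; g∣b to g∣r)

  gcd : ∀ a b → Gcd a b
  gcd a b with zero-or-degree b
  ... | inj₁ b≐0 = euclid 0 a b (λ k _ → at b≐0 k)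
  ... | inj₂ (m , _ , below) = euclid (suc m) a b below

  bezout : ∀ x y → Coprime2 x y → Σ P λ u → Σ P λ v → oneP ≐ addP (mulP u x) (mulP v y)
  bezout x y coprime = mulP w u , mulP w v , (begin
    oneP                                             ≈⟨ 1≐wg ⟩
    mulP w g                                         ≈⟨ mul-congʳ w g≐combination ⟩
    mulP w (addP (mulP u x) (mulP v y))
      ≈⟨ solve 5 (λ w u v x y → w :* (u :* x :+ v :* y) := (w :* u) :* x :+ (w :* v) :* y) ≐-refl w u v x y ⟩
    addP (mulP (mulP w u) x) (mulP (mulP w v) y)     ∎)
    where
    open Gcd (gcd x y)
    open ≐-Reasoning
    g∣1 : g ∣ oneP
    g∣1 = ∣P⇒∣ (coprime g (∣⇒∣P g∣a) (∣⇒∣P g∣b))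
    w = proj₁ g∣1
    1≐wg = proj₂ g∣1

  coprime⇒∣-cancel : ∀ {x y g m} → Coprime2 x y → g ∣ mulP x m → g ∣ mulP y m → g ∣ m
  coprime⇒∣-cancel {x} {y} {g} {m} coprime g∣xm g∣ym with bezout x y coprime
  ... | u , v , 1≐ux+vy = ∣-respʳ combination (∣-+ (∣-* u g∣xm) (∣-* v g∣ym))
    where
    open ≐-Reasoning
    combination : addP (mulP u (mulP x m)) (mulP v (mulP y m)) ≐ m
    combination = begin
      addP (mulP u (mulP x m)) (mulP v (mulP y m))
        ≈⟨ solve 5 (λ u x v y m → u :* (x :* m) :+ v :* (y :* m) := (u :* x :+ v :* y) :* m) ≐-refl u x v y m ⟩
      mulP (addP (mulP u x) (mulP v y)) m   ≈⟨ mul-congˡ m (≐-sym 1≐ux+vy) ⟩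
      mulP oneP m                          ≈⟨ mul-identityˡ m ⟩
      m                                    ∎

  coprime-divisor : ∀ {k d r} → Coprime2 k d → d ∣ mulP k r → d ∣ r
  coprime-divisor {k} {d} {r} coprime d∣kr = coprime⇒∣-cancel {k} {d} coprime d∣kr (r , mul-comm d r)

  bezout-nonzeroˡ : ∀ x y → Coprime2 x y → NonZeroP y →
    Σ P λ u → Σ P λ v → NonZeroP u × oneP ≐ addP (mulP u x) (mulP v y)
  bezout-nonzeroˡ x y coprime y≢0 with bezout x y coprime
  ... | u , v , 1≐ux+vy with ≐[]? u
  ...   | no u≢0 = u , v , u≢0 , 1≐ux+vy
  ...   | yes u≐0 = addP u y , subP v x ,
    (λ u+y≐0 → y≢0 (≐-trans (add-cong (≐-sym u≐0) ≐-refl) u+y≐0)) ,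
    ≐-trans 1≐ux+vy (solve 4 (λ u v x y → u :* x :+ v :* y := (u :+ y) :* x :+ (v :- x) :* y) ≐-refl u v x y)

  -- Absolute values

  monic⇒nonzero : ∀ {p} → Monic p → NonZeroP p
  monic⇒nonzero {p} monic p≐0 with trans (sym (cong lastF (≐⇒≈P p≐0))) monic
  ... | ()

  HasDegree-oneP : HasDegree oneP 0
  HasDegree-oneP = (λ 1≡0 → 0≢1 (sym 1≡0)) , λ { zero () ; (suc m) _ → refl }

  absFrac-HasDegree : ∀ {p s a e} → HasDegree p a → HasDegree s e → absFrac p s ≡ just (+ a ℤ.- + e)
  absFrac-HasDegree {p} {s} has-p has-s
    with deg p | deg s | deg-HasDegree {p} has-p | deg-HasDegree {s} has-s
  ... | _ | _ | refl | refl = refl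

  absFrac-zero : ∀ {p} s → p ≐ [] → absFrac p s ≡ nothing
  absFrac-zero {p} s p≐0 with deg p | deg-zero {p} p≐0
  ... | _ | refl = refl

  absFrac-cong : ∀ {p p'} s → p ≐ p' → absFrac p s ≡ absFrac p' s
  absFrac-cong {p} {p'} s e with deg p | deg p' | deg-cong {p} {p'} e
  ... | _ | _ | refl = refl

  ≤A-refl : ∀ x → x ≤A x
  ≤A-refl nothing = tt
  ≤A-refl (just m) = ℤP.≤-refl

  ≤A-maxˡ : ∀ {x y} z → x ≤A y → x ≤A maxA y z
  ≤A-maxˡ {nothing} z _ = tt
  ≤A-maxˡ {just _} {just n} nothing le = le
  ≤A-maxˡ {just _} {just n} (just m) le = ℤP.≤-trans le (ℤP.i≤i⊔j n m)

  ≤A-maxʳ : ∀ {x z} y → x ≤A z → x ≤A maxA y z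
  ≤A-maxʳ {nothing} y _ = tt
  ≤A-maxʳ nothing le = le
  ≤A-maxʳ {just _} {just m} (just n) le = ℤP.≤-trans le (ℤP.i≤j⊔i n m)

  absFrac-mul-mono : ∀ p w s → NonZeroP w → NonZeroP s → absFrac p s ≤A absFrac (mulP p w) s
  absFrac-mul-mono p w s w≢0 s≢0 with zero-or-degree p | zero-or-degree w | zero-or-degree s
  ... | inj₁ p≐0 | _ | _ rewrite absFrac-zero s p≐0 = tt
  ... | inj₂ _ | inj₁ w≐0 | _ = ⊥-elim (w≢0 w≐0)
  ... | inj₂ _ | inj₂ _ | inj₁ s≐0 = ⊥-elim (s≢0 s≐0)
  ... | inj₂ (a , has-p) | inj₂ (b , has-w) | inj₂ (e , has-s)
    rewrite absFrac-HasDegree {p} {s} has-p has-s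
          | absFrac-HasDegree {mulP p w} {s} (HasDegree-mul {p} {w} has-p has-w) has-s =
    ℤP.+-monoˡ-≤ (ℤ.- + e) (ℤ.+≤+ (ℕP.m≤m+n a b))

  coef-mul-nonzero⇒≤degrees : ∀ p s n → coef (mulP p s) n ≢ 0F →
    Σ ℕ λ a → Σ ℕ λ b → HasDegree p a × HasDegree s b × n ℕ.≤ a ℕ.+ b
  coef-mul-nonzero⇒≤degrees p s n ps≢0 with zero-or-degree p | zero-or-degree s
  ... | inj₁ p≐0 | _ = ⊥-elim (ps≢0 (at (mul-zeroˡ {p} s (≐-sym p≐0)) n))
  ... | inj₂ _ | inj₁ s≐0 = ⊥-elim (ps≢0 (at (≐-trans (mul-congʳ p s≐0) (mul-zeroʳ p)) n))
  ... | inj₂ (a , has-p) | inj₂ (b , has-s) with n ℕ.≤? a ℕ.+ b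
  ...   | yes n≤a+b = a , b , has-p , has-s , n≤a+b
  ...   | no n≰a+b = ⊥-elim (ps≢0 (proj₂ (HasDegree-mul {p} {s} has-p has-s) n (ℕP.≰⇒> n≰a+b)))

  one≤absP*absFrac : ∀ p s t n e → HasDegree t e → e ℕ.≤ n → coef (mulP p s) n ≢ 0F →
    one ≤A mulA (absP p) (absFrac s t)
  one≤absP*absFrac p s t n e has-t e≤n ps≢0 with coef-mul-nonzero⇒≤degrees p s n ps≢0
  ... | a , b , has-p , has-s , n≤a+b
    rewrite absFrac-HasDegree {p} {oneP} has-p HasDegree-oneP | absFrac-HasDegree {s} {t} has-s has-t =
    subst (+ 0 ℤ.≤_) a+b-e≡ (ℤP.i≤j⇒0≤j-i (ℤ.+≤+ (ℕP.≤-trans e≤n n≤a+b)))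
    where
    a+b-e≡ : + (a ℕ.+ b) ℤ.- + e ≡ (+ a ℤ.- + 0) ℤ.+ (+ b ℤ.- + e)
    a+b-e≡ = trans (cong (ℤ._- + e) (ℤP.pos-+ a b))
      (trans (ℤP.+-assoc (+ a) (+ b) (ℤ.- + e)) (cong (ℤ._+ (+ b ℤ.- + e)) (sym (ℤP.+-identityʳ (+ a)))))

  -- Ultrametric inequality: the top coefficient of k t must come from one of the two products.
  one≤max-absP*absFrac : ∀ p₀ s₀ p₁ s₁ k t →
    addP (mulP p₀ s₀) (mulP p₁ s₁) ≐ mulP k t → NonZeroP k → NonZeroP t →
    one ≤A maxA (mulA (absP p₀) (absFrac s₀ t)) (mulA (absP p₁) (absFrac s₁ t))
  one≤max-absP*absFrac p₀ s₀ p₁ s₁ k t e k≢0 t≢0 with zero-or-degree k | zero-or-degree t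
  ... | inj₁ k≐0 | _ = ⊥-elim (k≢0 k≐0)
  ... | inj₂ _ | inj₁ t≐0 = ⊥-elim (t≢0 t≐0)
  ... | inj₂ (κ , has-k) | inj₂ (ε , has-t) with coef (mulP p₀ s₀) (κ ℕ.+ ε) ≟F 0F
  ...   | no top₀≢0 =
    ≤A-maxˡ (mulA (absP p₁) (absFrac s₁ t))
            (one≤absP*absFrac p₀ s₀ t (κ ℕ.+ ε) ε has-t (ℕP.m≤n+m ε κ) top₀≢0)
  ...   | yes top₀≡0 =
    ≤A-maxʳ (mulA (absP p₀) (absFrac s₀ t))
            (one≤absP*absFrac p₁ s₁ t (κ ℕ.+ ε) ε has-t (ℕP.m≤n+m ε κ) top₁≢0)
    where
    top₁≢0 : coef (mulP p₁ s₁) (κ ℕ.+ ε) ≢ 0F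
    top₁≢0 top₁≡0 = proj₁ (HasDegree-mul {k} {t} has-k has-t) (begin
      coef (mulP k t) (κ ℕ.+ ε)
        ≡⟨ at e (κ ℕ.+ ε) ⟨
      coef (addP (mulP p₀ s₀) (mulP p₁ s₁)) (κ ℕ.+ ε)
        ≡⟨ coef-add (mulP p₀ s₀) (mulP p₁ s₁) (κ ℕ.+ ε) ⟩
      coef (mulP p₀ s₀) (κ ℕ.+ ε) +F coef (mulP p₁ s₁) (κ ℕ.+ ε)
        ≡⟨ cong₂ _+F_ top₀≡0 top₁≡0 ⟩
      0F +F 0F
        ≡⟨ Fr.+-identityˡ 0F ⟩
      0F ∎)
      where open ≡-Reasoning

  -- Points on the lines L₁(dc, k)

  primitive⇒nonzero : ∀ {c} → Primitive c → c zero ≐ [] → c (suc zero) ≐ [] → ⊥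
  primitive⇒nonzero (_ , inj₁ monic) c₀≐0 _ = monic⇒nonzero monic c₀≐0
  primitive⇒nonzero (_ , inj₂ (_ , monic)) _ c₁≐0 = monic⇒nonzero monic c₁≐0

  bezout-vector : ∀ c → Coprime2 (c zero) (c (suc zero)) → Σ Vec2 λ w → oneP ≐ dot w c
  bezout-vector c coprime with bezout (c zero) (c (suc zero)) coprime
  ... | u , v , 1≐uc₀+vc₁ = (λ { zero → u ; (suc zero) → v }) , 1≐uc₀+vc₁

  orthogonal⇒perp-multiple : ∀ c → Coprime2 (c zero) (c (suc zero)) → ∀ x → dot c x ≐ [] →
    Σ P λ m → ∀ i → x i ≐ mulP (perp c i) m
  orthogonal⇒perp-multiple c coprime x c·x≐0 = m , λ i → ≐-sym (begin
    mulP (perp c i) m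
      ≈⟨ perp-m≐ i ⟩
    subP (mulP (dot w c) (x i)) (mulP (w i) (dot c x))
      ≈⟨ add-cong (mul-congˡ (x i) (≐-sym 1≐w·c))
                  (neg-cong (≐-trans (mul-congʳ (w i) c·x≐0) (mul-zeroʳ (w i)))) ⟩
    subP (mulP oneP (x i)) []
      ≈⟨ ≐-trans (add-identityʳ _) (mul-identityˡ (x i)) ⟩
    x i ∎)
    where
    open ≐-Reasoning
    w = proj₁ (bezout-vector c coprime)
    1≐w·c = proj₂ (bezout-vector c coprime)
    m = subP (mulP (w zero) (x (suc zero))) (mulP (w (suc zero)) (x zero))
    perp-m≐ : ∀ i → mulP (perp c i) m ≐ subP (mulP (dot w c) (x i)) (mulP (w i) (dot c x))
    perp-m≐ zero = solve 6 (λ c₀ c₁ w₀ w₁ x₀ x₁ →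
      (:- c₁) :* (w₀ :* x₁ :- w₁ :* x₀) := (w₀ :* c₀ :+ w₁ :* c₁) :* x₀ :- w₀ :* (c₀ :* x₀ :+ c₁ :* x₁))
      ≐-refl (c zero) (c (suc zero)) (w zero) (w (suc zero)) (x zero) (x (suc zero))
    perp-m≐ (suc zero) = solve 6 (λ c₀ c₁ w₀ w₁ x₀ x₁ →
      c₀ :* (w₀ :* x₁ :- w₁ :* x₀) := (w₀ :* c₀ :+ w₁ :* c₁) :* x₁ :- w₁ :* (c₀ :* x₀ :+ c₁ :* x₁))
      ≐-refl (c zero) (c (suc zero)) (w zero) (w (suc zero)) (x zero) (x (suc zero))

  orthogonal⇒d·perp-multiple : ∀ {d} c → Coprime2 (c zero) (c (suc zero)) → ∀ x →
    (∀ i → d ∣ x i) → dot c x ≐ [] → Σ P λ w → ∀ i → x i ≐ mulP (mulP d (perp c i)) w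
  orthogonal⇒d·perp-multiple {d} c coprime x d∣x c·x≐0 = w , λ i → begin
    x i                          ≈⟨ x≐perp·m i ⟩
    mulP (perp c i) m            ≈⟨ mul-congʳ (perp c i) m≐wd ⟩
    mulP (perp c i) (mulP w d)   ≈⟨ solve 3 (λ p w d → p :* (w :* d) := (d :* p) :* w) ≐-refl (perp c i) w d ⟩
    mulP (mulP d (perp c i)) w   ∎
    where
    open ≐-Reasoning
    m = proj₁ (orthogonal⇒perp-multiple c coprime x c·x≐0)
    x≐perp·m = proj₂ (orthogonal⇒perp-multiple c coprime x c·x≐0)
    d∣c₁m : d ∣ mulP (c (suc zero)) m
    d∣c₁m = ∣-respʳ (≐-trans (neg-cong (x≐perp·m zero))
                     (solve 2 (λ c₁ m → :- ((:- c₁) :* m) := c₁ :* m) ≐-refl (c (suc zero)) m))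
                    (∣-neg (d∣x zero))
    d∣m : d ∣ m
    d∣m = coprime⇒∣-cancel {c zero} {c (suc zero)} coprime
            (∣-respʳ (x≐perp·m (suc zero)) (d∣x (suc zero))) d∣c₁m
    w = proj₁ d∣m
    m≐wd = proj₂ d∣m

  on-line⇒≐ : ∀ d c k a r → OnL1 d c k a r → mulP d (dot c a) ≐ mulP k r
  on-line⇒≐ d c k a r on = ≈P⇒≐ {mulP d (dot c a)} {mulP k r} on

  on-line⇒d∣r : ∀ d c k a r → Coprime2 k d → OnL1 d c k a r → d ∣ r
  on-line⇒d∣r d c k a r k⊥d on =
    coprime-divisor {k} {d} k⊥d (dot c a , ≐-trans (≐-sym (on-line⇒≐ d c k a r on)) (mul-comm d (dot c a)))

  δ-num : Vec2 → P → Vec2 → P → Fin 2 → P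
  δ-num a r a' r' i = subP (mulP (a i) r') (mulP (a' i) r)

  d·c·δ-num : ∀ d c k k' a a' r r' → OnL1 d c k a r → OnL1 d c k' a' r' →
    mulP d (dot c (δ-num a r a' r')) ≐ mulP (subP k k') (mulP r r')
  d·c·δ-num d c k k' a a' r r' on on' = begin
    mulP d (dot c (δ-num a r a' r'))
      ≈⟨ solve 9 (λ d c₀ c₁ a₀ a₁ a'₀ a'₁ r r' →
           d :* (c₀ :* (a₀ :* r' :- a'₀ :* r) :+ c₁ :* (a₁ :* r' :- a'₁ :* r))
           := (d :* (c₀ :* a₀ :+ c₁ :* a₁)) :* r' :- (d :* (c₀ :* a'₀ :+ c₁ :* a'₁)) :* r)
         ≐-refl d (c zero) (c (suc zero)) (a zero) (a (suc zero)) (a' zero) (a' (suc zero)) r r' ⟩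
    subP (mulP (mulP d (dot c a)) r') (mulP (mulP d (dot c a')) r)
      ≈⟨ add-cong (mul-congˡ r' (on-line⇒≐ d c k a r on)) (neg-cong (mul-congˡ r (on-line⇒≐ d c k' a' r' on'))) ⟩
    subP (mulP (mulP k r) r') (mulP (mulP k' r') r)
      ≈⟨ solve 4 (λ k k' r r' → (k :* r) :* r' :- (k' :* r') :* r := (k :- k') :* (r :* r')) ≐-refl k k' r r' ⟩
    mulP (subP k k') (mulP r r') ∎
    where open ≐-Reasoning

  same-line⇒far : ∀ {d c a a' r r'} → Coprime2 (c zero) (c (suc zero)) → d ∣ r → d ∣ r' →
    NonZeroP (mulP r r') → Distinct a r a' r' → dot c (δ-num a r a' r') ≐ [] →
    ∀ i → absFrac (mulP d (perp c i)) (mulP r r') ≤A δ a r a' r' i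
  same-line⇒far {d} {c} {a} {a'} {r} {r'} coprime d∣r d∣r' rr'≢0 distinct c·δ≐0 i =
    subst (absFrac (mulP d (perp c i)) (mulP r r') ≤A_) (sym (absFrac-cong (mulP r r') (δ≐ i)))
      (absFrac-mul-mono (mulP d (perp c i)) w (mulP r r') w≢0 rr'≢0)
    where
    d∣δ : ∀ i → d ∣ δ-num a r a' r' i
    d∣δ i = ∣-+ (∣-* (a i) d∣r') (∣-neg (∣-* (a' i) d∣r))
    w = proj₁ (orthogonal⇒d·perp-multiple c coprime (δ-num a r a' r') d∣δ c·δ≐0)
    δ≐ = proj₂ (orthogonal⇒d·perp-multiple c coprime (δ-num a r a' r') d∣δ c·δ≐0)
    w≢0 : NonZeroP w
    w≢0 w≐0 = distinct λ i → ≐⇒≈P (P⁻.x∙y⁻¹≈ε⇒x≈y (mulP (a i) r') (mulP (a' i) r)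
      (≐-trans (δ≐ i) (≐-trans (mul-congʳ (mulP d (perp c i)) w≐0) (mul-zeroʳ (mulP d (perp c i))))))

  separation : (d : P) → Monic d → (c : Vec2) → Primitive c →
    (a a' : Vec2) (r r' : P) → Lowest a r → Lowest a' r' →
    InL d c a r → InL d c a' r' → Distinct a r a' r' →
    (∀ i → absFrac (mulP d (perp c i)) (mulP r r') ≤A δ a r a' r' i)
    ⊎ (maxA (absFrac oneP r) (absFrac oneP r') ≤A maxA (δ a r a' r' zero) (δ a r a' r' (suc zero)))
    ⊎ (one ≤A maxA (mulA (absP (mulP d (c zero))) (δ a r a' r' zero))
                   (mulA (absP (mulP d (c (suc zero)))) (δ a r a' r' (suc zero))))
  separation d monic c c-primitive a a' r r' _ _ (r≢0 , _ , k , on , k⊥d) (r'≢0 , _ , k' , on' , k'⊥d) distinct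
    with ≐[]? (subP k k')
       | mul-nonzero {r} {r'} (λ r≐0 → r≢0 (≐⇒≈P r≐0)) (λ r'≐0 → r'≢0 (≐⇒≈P r'≐0))
  ... | yes k-k'≐0 | rr'≢0 =
    inj₁ (same-line⇒far {d} {c} {a} {a'} {r} {r'} (proj₁ c-primitive)
            (on-line⇒d∣r d c k a r k⊥d on) (on-line⇒d∣r d c k' a' r' k'⊥d on') rr'≢0 distinct c·δ≐0)
    where
    c·δ≐0 : dot c (δ-num a r a' r') ≐ []
    c·δ≐0 = mul-cancelˡ {d} (monic⇒nonzero monic)
      (≐-trans (d·c·δ-num d c k k' a a' r r' on on')
               (≐-trans (mul-zeroˡ (mulP r r') (≐-sym k-k'≐0)) (≐-sym (mul-zeroʳ d))))
  ... | no k-k'≢0 | rr'≢0 =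
    inj₂ (inj₂ (one≤max-absP*absFrac (mulP d (c zero)) (δ-num a r a' r' zero)
                                     (mulP d (c (suc zero))) (δ-num a r a' r' (suc zero))
                                     (subP k k') (mulP r r') distributed k-k'≢0 rr'≢0))
    where
    n₀ = δ-num a r a' r' zero
    n₁ = δ-num a r a' r' (suc zero)
    distributed : addP (mulP (mulP d (c zero)) n₀) (mulP (mulP d (c (suc zero))) n₁) ≐ mulP (subP k k') (mulP r r')
    distributed = ≐-trans
      (solve 5 (λ d c₀ c₁ n₀ n₁ → (d :* c₀) :* n₀ :+ (d :* c₁) :* n₁ := d :* (c₀ :* n₀ :+ c₁ :* n₁))
             ≐-refl d (c zero) (c (suc zero)) n₀ n₁)
      (d·c·δ-num d c k k' a a' r r' on on')

  module NearbyPoint {d c k a r} (d≢0 : NonZeroP d) (c-primitive : Primitive c) (k⊥d : Coprime2 k d)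
    (r≢0 : NonZeroP r) (a-lowest : Coprime3 (a zero) (a (suc zero)) r) (on : OnL1 d c k a r) where

    open ≐-Reasoning

    private
      c-coprime = proj₁ c-primitive
      d∣r = on-line⇒d∣r d c k a r k⊥d on
      w = proj₁ (bezout-vector c c-coprime)
      1≐w·c = proj₂ (bezout-vector c c-coprime)

    s = proj₁ d∣r

    r≐sd : r ≐ mulP s d
    r≐sd = proj₂ d∣r

    s≢0 : NonZeroP s
    s≢0 s≐0 = r≢0 (≐-trans r≐sd (mul-zeroˡ d (≐-sym s≐0)))

    c·a≐ks : dot c a ≐ mulP k s
    c·a≐ks = mul-cancelˡ {d} d≢0 (begin
      mulP d (dot c a)  ≈⟨ on-line⇒≐ d c k a r on ⟩
      mulP k r          ≈⟨ mul-congʳ k r≐sd ⟩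
      mulP k (mulP s d) ≈⟨ solve 3 (λ k s d → k :* (s :* d) := d :* (k :* s)) ≐-refl k s d ⟩
      mulP d (mulP k s) ∎)

    ν-decomposition : Σ P λ ν → ∀ i → a i ≐ addP (mulP (perp c i) ν) (mulP (mulP s k) (w i))
    ν-decomposition = ν , λ i → ≐-trans (a≐z+skw i) (add-cong (z≐perp·ν i) ≐-refl)
      where
      z : Vec2
      z i = subP (a i) (mulP (mulP s k) (w i))
      a≐z+skw : ∀ i → a i ≐ addP (z i) (mulP (mulP s k) (w i))
      a≐z+skw i = solve 2 (λ a t → a := (a :- t) :+ t) ≐-refl (a i) (mulP (mulP s k) (w i))
      c·z≐0 : dot c z ≐ []
      c·z≐0 = begin
        dot c z
          ≈⟨ solve 8 (λ c₀ c₁ a₀ a₁ s k w₀ w₁ →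
               c₀ :* (a₀ :- (s :* k) :* w₀) :+ c₁ :* (a₁ :- (s :* k) :* w₁)
               := (c₀ :* a₀ :+ c₁ :* a₁) :- (s :* k) :* (w₀ :* c₀ :+ w₁ :* c₁))
             ≐-refl (c zero) (c (suc zero)) (a zero) (a (suc zero)) s k (w zero) (w (suc zero)) ⟩
        subP (dot c a) (mulP (mulP s k) (dot w c))
          ≈⟨ add-cong c·a≐ks (neg-cong (mul-congʳ (mulP s k) (≐-sym 1≐w·c))) ⟩
        subP (mulP k s) (mulP (mulP s k) oneP)
          ≈⟨ add-cong ≐-refl (neg-cong (mul-identityʳ (mulP s k))) ⟩
        subP (mulP k s) (mulP s k)
          ≈⟨ P⁻.x≈y⇒x∙y⁻¹≈ε (mul-comm k s) ⟩
        [] ∎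
      ν = proj₁ (orthogonal⇒perp-multiple c c-coprime z c·z≐0)
      z≐perp·ν = proj₂ (orthogonal⇒perp-multiple c c-coprime z c·z≐0)

    ν = proj₁ ν-decomposition
    a≐ = proj₂ ν-decomposition

    ν⊥s : Coprime2 ν s
    ν⊥s g g∣ν g∣s = a-lowest g (∣⇒∣P (g∣a zero)) (∣⇒∣P (g∣a (suc zero))) (∣⇒∣P g∣r)
      where
      g∣a : ∀ i → g ∣ a i
      g∣a i = ∣-respʳ (≐-sym (a≐ i)) (∣-+ (∣-* (perp c i) (∣P⇒∣ g∣ν))
        (∣-respʳ (solve 3 (λ k w s → (k :* w) :* s := (s :* k) :* w) ≐-refl k (w i) s)
                 (∣-* (mulP k (w i)) (∣P⇒∣ g∣s))))
      g∣r : g ∣ r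
      g∣r = ∣-respʳ (≐-trans (mul-comm d s) (≐-sym r≐sd)) (∣-* d (∣P⇒∣ g∣s))

    private
      u,t = bezout-nonzeroˡ ν s ν⊥s s≢0
      u = proj₁ u,t
      t = proj₁ (proj₂ u,t)
      u≢0 = proj₁ (proj₂ (proj₂ u,t))
      1≐uν+ts = proj₂ (proj₂ (proj₂ u,t))

    b : Vec2
    b i = subP (mulP (mulP k u) (w i)) (mulP t (perp c i))

    r₂ : P
    r₂ = mulP d u

    r₂≢0 : NonZeroP r₂
    r₂≢0 = mul-nonzero {d} {u} d≢0 u≢0

    δ-num≐d·perp : ∀ i → δ-num a r b r₂ i ≐ mulP d (perp c i)
    δ-num≐d·perp i = begin
      subP (mulP (a i) r₂) (mulP (b i) r)
        ≈⟨ add-cong (mul-congˡ r₂ (a≐ i)) (neg-cong (mul-congʳ (b i) r≐sd)) ⟩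
      subP (mulP (addP (mulP (perp c i) ν) (mulP (mulP s k) (w i))) (mulP d u)) (mulP (b i) (mulP s d))
        ≈⟨ solve 8 (λ p ν s k w d u t →
             (p :* ν :+ (s :* k) :* w) :* (d :* u) :- ((k :* u) :* w :- t :* p) :* (s :* d)
             := (d :* p) :* (u :* ν :+ t :* s))
           ≐-refl (perp c i) ν s k (w i) d u t ⟩
      mulP (mulP d (perp c i)) (addP (mulP u ν) (mulP t s))
        ≈⟨ mul-congʳ (mulP d (perp c i)) (≐-sym 1≐uν+ts) ⟩
      mulP (mulP d (perp c i)) oneP
        ≈⟨ mul-identityʳ (mulP d (perp c i)) ⟩
      mulP d (perp c i) ∎

    c·b≐ku : dot c b ≐ mulP k u
    c·b≐ku = begin
      dot c b
        ≈⟨ solve 7 (λ c₀ c₁ k u t w₀ w₁ →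
             c₀ :* ((k :* u) :* w₀ :- t :* (:- c₁)) :+ c₁ :* ((k :* u) :* w₁ :- t :* c₀)
             := (k :* u) :* (w₀ :* c₀ :+ w₁ :* c₁))
           ≐-refl (c zero) (c (suc zero)) k u t (w zero) (w (suc zero)) ⟩
      mulP (mulP k u) (dot w c) ≈⟨ mul-congʳ (mulP k u) (≐-sym 1≐w·c) ⟩
      mulP (mulP k u) oneP      ≈⟨ mul-identityʳ (mulP k u) ⟩
      mulP k u ∎

    b-on-line : OnL1 d c k b r₂
    b-on-line = ≐⇒≈P (≐-trans (mul-congʳ d c·b≐ku)
      (solve 3 (λ d k u → d :* (k :* u) := k :* (d :* u)) ≐-refl d k u))

    -- A common divisor of b and r₂ = d u divides c·b = k u, hence u (as k ⊥ d),
    -- hence c^⊥ = a u - s b.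
    b-lowest : Coprime3 (b zero) (b (suc zero)) r₂
    b-lowest g g∣b₀ g∣b₁ g∣r₂ = c-coprime g (∣⇒∣P (g∣perp (suc zero)))
      (∣⇒∣P (∣-respʳ (solve 1 (λ c₁ → :- (:- c₁) := c₁) ≐-refl (c (suc zero))) (∣-neg (g∣perp zero))))
      where
      g∣b : ∀ i → g ∣ b i
      g∣b zero = ∣P⇒∣ g∣b₀
      g∣b (suc zero) = ∣P⇒∣ g∣b₁
      g∣u : g ∣ u
      g∣u = coprime⇒∣-cancel {k} {d} k⊥d
        (∣-respʳ c·b≐ku (∣-+ (∣-* (c zero) (g∣b zero)) (∣-* (c (suc zero)) (g∣b (suc zero)))))
        (∣P⇒∣ g∣r₂)
      au-sb≐perp : ∀ i → subP (mulP (a i) u) (mulP s (b i)) ≐ perp c i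
      au-sb≐perp i = begin
        subP (mulP (a i) u) (mulP s (b i))
          ≈⟨ add-cong (mul-congˡ u (a≐ i)) ≐-refl ⟩
        subP (mulP (addP (mulP (perp c i) ν) (mulP (mulP s k) (w i))) u) (mulP s (b i))
          ≈⟨ solve 7 (λ p ν s k w u t →
               (p :* ν :+ (s :* k) :* w) :* u :- s :* ((k :* u) :* w :- t :* p) := p :* (u :* ν :+ t :* s))
             ≐-refl (perp c i) ν s k (w i) u t ⟩
        mulP (perp c i) (addP (mulP u ν) (mulP t s))
          ≈⟨ mul-congʳ (perp c i) (≐-sym 1≐uν+ts) ⟩
        mulP (perp c i) oneP
          ≈⟨ mul-identityʳ (perp c i) ⟩
        perp c i ∎
      g∣perp : ∀ i → g ∣ perp c i
      g∣perp i = ∣-respʳ (au-sb≐perp i) (∣-+ (∣-* (a i) g∣u) (∣-neg (∣-* s (g∣b i))))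

    b-distinct : Distinct b r₂ a r
    b-distinct same = primitive⇒nonzero {c} c-primitive
      (perp≐0 (suc zero))
      (≐-trans (solve 1 (λ c₁ → c₁ := :- (:- c₁)) ≐-refl (c (suc zero))) (neg-cong (perp≐0 zero)))
      where
      perp≐0 : ∀ i → perp c i ≐ []
      perp≐0 i = mul-cancelˡ {d} d≢0 (begin
        mulP d (perp c i)     ≈⟨ δ-num≐d·perp i ⟨
        δ-num a r b r₂ i      ≈⟨ P⁻.x≈y⇒x∙y⁻¹≈ε (≐-sym (≈P⇒≐ {mulP (b i) r} {mulP (a i) r₂} (same i))) ⟩
        []                    ≈⟨ mul-zeroʳ d ⟨
        mulP d []             ∎)

    b-close : ∀ i → δ a r b r₂ i ≤A absFrac (mulP d (perp c i)) (mulP r r₂)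
    b-close i = subst (_≤A absFrac (mulP d (perp c i)) (mulP r r₂))
      (sym (absFrac-cong (mulP r r₂) (δ-num≐d·perp i))) (≤A-refl _)

  on-line-unique : ∀ d c k k' a r → NonZeroP r → OnL1 d c k a r → OnL1 d c k' a r → k ≐ k'
  on-line-unique d c k k' a r r≢0 on on' = mul-cancelˡ {r} r≢0 (begin
    mulP r k          ≈⟨ mul-comm r k ⟩
    mulP k r          ≈⟨ on-line⇒≐ d c k a r on ⟨
    mulP d (dot c a)  ≈⟨ on-line⇒≐ d c k' a r on' ⟩
    mulP k' r         ≈⟨ mul-comm k' r ⟩
    mulP r k'         ∎)
    where open ≐-Reasoning

  Coprime2-respˡ : ∀ {k k' d} → k ≐ k' → Coprime2 k' d → Coprime2 k d
  Coprime2-respˡ k≐k' k'⊥d g (u , k≈ug) g∣d = k'⊥d g (u , trans (sym (≐⇒≈P k≐k')) k≈ug) g∣d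

  neighbour : (d : P) → Monic d → (c : Vec2) → Primitive c →
    (a : Vec2) (r k : P) → Lowest a r → InL d c a r → OnL1 d c k a r →
    ∃₂ λ (b : Vec2) (r₂ : P) → Lowest b r₂ × OnL1 d c k b r₂ × Distinct b r₂ a r
      × (∀ i → δ a r b r₂ i ≤A absFrac (mulP d (perp c i)) (mulP r r₂))
  neighbour d monic c c-primitive a r k (r≉0 , a-lowest) (_ , _ , k₀ , on₀ , k₀⊥d) on =
    b , r₂ , ((λ r₂≈0 → r₂≢0 (≈P⇒≐ r₂≈0)) , b-lowest) , b-on-line , b-distinct , b-close
    where
    r≢0 : NonZeroP r
    r≢0 r≐0 = r≉0 (≐⇒≈P r≐0)
    k⊥d : Coprime2 k d
    k⊥d = Coprime2-respˡ {k} {k₀} {d} (on-line-unique d c k k₀ a r r≢0 on on₀) k₀⊥d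
    open NearbyPoint {d} {c} {k} {a} {r} (monic⇒nonzero {d} monic) c-primitive k⊥d r≢0 a-lowest on

lemma2p6 : (FF : FiniteField) → let open Poly FF in
    (d : P) → Monic d → (c : Vec2) → Primitive c →
    ((a a' : Vec2) (r r' : P) → Lowest a r → Lowest a' r' →
      InL d c a r → InL d c a' r' → Distinct a r a' r' →
      (∀ i → absFrac (mulP d (perp c i)) (mulP r r') ≤A δ a r a' r' i)
      ⊎ (maxA (absFrac oneP r) (absFrac oneP r') ≤A maxA (δ a r a' r' zero) (δ a r a' r' (suc zero)))
      ⊎ (one ≤A maxA (mulA (absP (mulP d (c zero))) (δ a r a' r' zero))
                     (mulA (absP (mulP d (c (suc zero)))) (δ a r a' r' (suc zero)))))
    × ((a : Vec2) (r k : P) → Lowest a r → InL d c a r → OnL1 d c k a r →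
      ∃₂ λ (b : Vec2) (r₂ : P) → Lowest b r₂ × OnL1 d c k b r₂ × Distinct b r₂ a r
        × (∀ i → δ a r b r₂ i ≤A absFrac (mulP d (perp c i)) (mulP r r₂)))
lemma2p6 FF d monic c c-primitive = separation d monic c c-primitive , neighbour d monic c c-primitive
  where open Polynomials FF
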